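{- Let $\mathcal{F}\subseteq 2^{[n]}$ be such that $G_\mathcal{F}$ is disconnected and, for every $X\in 2^{[n]}\setminus\mathcal{F}$, the graph $G_{\mathcal{F}\cup\{X\}}$ is connected, and suppose $G_\mathcal{F}$ consists of two components with vertex sets $\mathcal{A}$ and $\mathcal{B}$. Then \[ |\partial^+(\mathcal{F}^+)|+|\partial^-(\mathcal{F}^-)|\ge\begin{cases}2^{n/2+1}-2 & \text{if $n$ is even},\\ 3\cdot 2^{(n-1)/2}-2 & \text{if $n$ is odd}.\end{cases} \]
   Context: For $\mathcal{F}\subseteq 2^{[n]}$, $G_\mathcal{F}$ is the graph on $\mathcal{F}$ with distinct $A,B$ adjacent iff $A\subseteq B$ or $B\subseteq A$. For a family $\mathcal{G}$, $\partial^+(\mathcal{G})=\{X\subseteq[n]: G\subseteq X\text{ for some }G\in\mathcal{G}\}$ and $\partial^-(\mathcal{G})=\{X\subseteq[n]: X\subseteq G\text{ for some }G\in\mathcal{G}\}$. $\mathcal{F}^+$ is the set of $F\subseteq[n]$ with $F\notin\partial^-(\mathcal{A})\cup\partial^-(\mathcal{B})$ such that every proper subset of $F$ lies in $\partial^-(\mathcal{A})\cup\partial^-(\mathcal{B})$; $\mathcal{F}^-$ is the set of $F\subseteq[n]$ with $F\notin\partial^+(\mathcal{A})\cup\partial^+(\mathcal{B})$ such that every proper superset of $F$ (within $[n]$) lies in $\partial^+(\mathcal{A})\cup\partial^+(\mathcal{B})$. -}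

module Defs where

open import Data.Nat using (ℕ; zero; suc; _∸_; _^_; _*_; _+_; _/_; _%_)
open import Data.Bool using (Bool; true; false; _∧_; _∨_; not; if_then_else_)
open import Data.Bool.Properties using () renaming (_≟_ to _≟ᵇ_)
open import Data.List using (List; []; _∷_; _++_; map; length; filterᵇ)
open import Data.Bool.ListAction using (any; all)
open import Data.Vec using ([]; _∷_)
open import Data.Vec.Properties using (≡-dec)
open import Data.Fin.Subset using (Subset; _⊆_; _⊂_; inside; outside)
open import Data.Fin.Subset.Properties using (_⊆?_; _⊂?_)
open import Data.Product using (_×_; ∃)
open import Data.Sum using (_⊎_)
open import Relation.Nullary using (¬_; does)
open import Relation.Binary.PropositionalEquality using (_≡_; _≢_)

Fam : ℕ → Set
Fam n = Subset n → Bool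

_≟ₛ_ : ∀ {n} (X Y : Subset n) → _
_≟ₛ_ = ≡-dec _≟ᵇ_

allSubsets : (n : ℕ) → List (Subset n)
allSubsets zero    = [] ∷ []
allSubsets (suc n) = map (outside ∷_) (allSubsets n) ++ map (inside ∷_) (allSubsets n)

card : ∀ {n} → Fam n → ℕ
card {n} 𝓕 = length (filterᵇ 𝓕 (allSubsets n))

insert : ∀ {n} → Subset n → Fam n → Fam n
insert X 𝓕 Y = 𝓕 Y ∨ does (Y ≟ₛ X)

-- Adjacency in G_𝓕: distinct and comparable.
Adj : ∀ {n} → Subset n → Subset n → Set
Adj A B = A ≢ B × (A ⊆ B ⊎ B ⊆ A)

data Path {n} (𝓕 : Fam n) : Subset n → Subset n → Set where
  here : ∀ {X} → 𝓕 X ≡ true → Path 𝓕 X X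
  step : ∀ {X Y Z} → 𝓕 X ≡ true → Adj X Y → Path 𝓕 Y Z → Path 𝓕 X Z

Connected : ∀ {n} → Fam n → Set
Connected 𝓕 = ∀ X Y → 𝓕 X ≡ true → 𝓕 Y ≡ true → Path 𝓕 X Y

TwoComponents : ∀ {n} → Fam n → Fam n → Fam n → Set
TwoComponents 𝓕 𝓐 𝓑 =
  (∀ X → 𝓕 X ≡ 𝓐 X ∨ 𝓑 X)
  × (∀ X → 𝓐 X ∧ 𝓑 X ≡ false)
  × ∃ (λ X → 𝓐 X ≡ true)
  × ∃ (λ X → 𝓑 X ≡ true)
  × Connected 𝓐
  × Connected 𝓑
  × (∀ X Y → 𝓐 X ≡ true → 𝓑 Y ≡ true → ¬ Adj X Y)

∂⁺ : ∀ {n} → Fam n → Fam n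
∂⁺ {n} 𝓖 X = any (λ G → 𝓖 G ∧ does (G ⊆? X)) (allSubsets n)

∂⁻ : ∀ {n} → Fam n → Fam n
∂⁻ {n} 𝓖 X = any (λ G → 𝓖 G ∧ does (X ⊆? G)) (allSubsets n)

𝓕⁺ : ∀ {n} → Fam n → Fam n → Fam n
𝓕⁺ {n} 𝓐 𝓑 F =
  not (∂⁻ 𝓐 F ∨ ∂⁻ 𝓑 F)
  ∧ all (λ Y → not (does (Y ⊂? F)) ∨ (∂⁻ 𝓐 Y ∨ ∂⁻ 𝓑 Y)) (allSubsets n)

𝓕⁻ : ∀ {n} → Fam n → Fam n → Fam n
𝓕⁻ {n} 𝓐 𝓑 F =
  not (∂⁺ 𝓐 F ∨ ∂⁺ 𝓑 F)
  ∧ all (λ Y → not (does (F ⊂? Y)) ∨ (∂⁺ 𝓐 Y ∨ ∂⁺ 𝓑 Y)) (allSubsets n)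

-- 2^{n/2+1} - 2 for n even, 3·2^{(n-1)/2} - 2 for n odd
-- (for odd n, (n-1)/2 equals the floor division n / 2).
bound : ℕ → ℕ
bound n with n % 2
... | zero  = 2 ^ (n / 2 + 1) ∸ 2
... | suc _ = 3 * 2 ^ (n / 2) ∸ 2

{-# OPTIONS --safe #-}
-- Put 𝓤 = ∂⁺(𝓐) and 𝓓 = ∂⁻(𝓐). As no member of 𝓐 is comparable with a member of 𝓑, the
-- members of 𝓐 lie in 𝓤 ∩ 𝓓, the members of 𝓑 lie outside 𝓤 ∪ 𝓓, and a set in exactly one
-- of 𝓤, 𝓓 lies above a set of 𝓕⁺ or below a set of 𝓕⁻. So it suffices that an up-set 𝓤 and
-- a down-set 𝓓 of 2^[n] having a point X in 𝓤 ∩ 𝓓 and a point Y outside 𝓤 ∪ 𝓓 satisfy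
-- |𝓤 ⊕ 𝓓| ≥ γ n, where γ 0 = 0, γ (m+1) = γ m + 2^⌊m/2⌋ is the bound of the statement.
--
-- Induction on n = m+1: cut the cube along a coordinate k into two halves. A half containing
-- points of both kinds contributes γ m by induction. If X lies in one half and the other half
-- has no point of 𝓤 ∩ 𝓓, then every set of that other half comparable with X lies in 𝓤 ⊕ 𝓓;
-- these form a subcube of dimension the number of coordinates of X (other than k) agreeing
-- with X k. Dually for Y. If one half lacks points of 𝓤 ∩ 𝓓 and the other lacks points outside
-- 𝓤 ∪ 𝓓, every pair of sets differing only at k meets 𝓤 ⊕ 𝓓, giving 2^m ≥ γ(m+1). Choosing k
-- so that X and Y both keep at least ⌊m/2⌋ such coordinates makes each case add up to γ(m+1).
module Submission where

open import Defs
open import Data.Nat using (ℕ; _≤_; _+_)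
open import Data.Bool using (Bool; true; false)
open import Data.Fin.Subset using (Subset)
open import Relation.Nullary using (¬_)
open import Relation.Binary.PropositionalEquality using (_≡_)

open import Data.Bool using (not; _∧_; _∨_; _xor_; T; T?; f≤t; b≤b) renaming (_≤_ to _≤ᵇ_)
open import Data.Bool.ListAction using (any; all)
open import Data.Bool.Properties using (T-≡; T-∧; ¬-not; not-¬) renaming (_≟_ to _≟ᵇ_)
open import Data.Empty using (⊥)
open import Data.Fin using (Fin; zero; suc)
open import Data.Fin.Subset using (_⊆_)
open import Data.Fin.Subset.Induction using (⊂-wellFounded; ⊃-wellFounded)
open import Data.Fin.Subset.Properties using (⊆-refl; ⊆-trans; drop-∷-⊆; out⊆; s⊆s; _⊆?_; _⊂?_; anySubset?)
open import Data.List using (List; []; _∷_; _++_; map; length; filterᵇ)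
open import Data.List.Membership.Propositional using (_∈_; lose)
open import Data.List.Membership.Propositional.Properties using (∈-map⁺; ∈-++⁺ˡ; ∈-++⁺ʳ)
open import Data.List.Properties using (length-++; filter-++)
open import Data.List.Relation.Unary.All using (universal)
open import Data.List.Relation.Unary.All.Properties using (all⁻)
open import Data.List.Relation.Unary.Any as Any using (satisfied)
open import Data.List.Relation.Unary.Any.Properties using (any⁺; any⁻)
open import Data.Nat using (NonZero; zero; suc; _<_; _*_; _^_; _∸_; _/_; _%_; ⌊_/2⌋; ⌈_/2⌉; z≤n; s≤s; _<?_)
open import Data.Nat.DivMod using (m≡m%n+[m/n]*n; m%n<n)
open import Data.Nat.Properties
open import Algebra.Properties.CommutativeSemigroup +-commutativeSemigroup using (interchange; xy∙z≈xz∙y)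
open import Data.Nat.Tactic.RingSolver using (solve-∀)
open import Data.Product using (∃; _×_; _,_; proj₁)
open import Data.Sum using (_⊎_; inj₁; inj₂)
open import Data.Vec using ([]; _∷_; here; insertAt; removeAt; lookup; count)
open import Data.Vec.Properties using (insertAt-removeAt)
open import Function using (_∘_; flip)
open import Function.Bundles using (module Equivalence)
open import Induction.WellFounded using (WellFounded; Acc; acc)
open import Level using (0ℓ)
open import Relation.Binary using (Rel; Decidable; Reflexive; Transitive; _⇒_)
open import Relation.Binary.PropositionalEquality
  using (_≢_; refl; sym; trans; cong; cong₂; subst; ≢-sym; module ≡-Reasoning)
open import Relation.Nullary using (Dec; yes; no; does; contradiction)
open import Relation.Nullary.Decidable using (_×-dec_; dec-true; toWitness; isYes≗does)

open Equivalence using (to; from)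

private
  variable
    n : ℕ

clash : ∀ {x} → x ≡ true → x ≡ false → ⊥
clash refl ()

-- Counting subfamilies of the cube

length-filterᵇ-map : ∀ {A B : Set} (p : B → Bool) (f : A → B) (xs : List A) →
                     length (filterᵇ p (map f xs)) ≡ length (filterᵇ (p ∘ f) xs)
length-filterᵇ-map p f []       = refl
length-filterᵇ-map p f (x ∷ xs) with p (f x)
... | true  = cong suc (length-filterᵇ-map p f xs)
... | false = length-filterᵇ-map p f xs

card-∷ : (𝓖 : Fam (suc n)) → card 𝓖 ≡ card (𝓖 ∘ (false ∷_)) + card (𝓖 ∘ (true ∷_))
card-∷ {n} 𝓖 = begin
  length (filterᵇ 𝓖 (lower ++ upper))                  ≡⟨ cong length (filter-++ (T? ∘ 𝓖) lower upper) ⟩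
  length (filterᵇ 𝓖 lower ++ filterᵇ 𝓖 upper)          ≡⟨ length-++ (filterᵇ 𝓖 lower) ⟩
  length (filterᵇ 𝓖 lower) + length (filterᵇ 𝓖 upper)  ≡⟨ cong₂ _+_ (length-filterᵇ-map 𝓖 (false ∷_) (allSubsets n))
                                                                      (length-filterᵇ-map 𝓖 (true ∷_) (allSubsets n)) ⟩
  card (𝓖 ∘ (false ∷_)) + card (𝓖 ∘ (true ∷_))         ∎
  where
  open ≡-Reasoning
  lower upper : List (Subset (suc n))
  lower = map (false ∷_) (allSubsets n)
  upper = map (true ∷_) (allSubsets n)

card-≤-+ : (𝓕 𝓖 𝓗 : Fam n) → (∀ X → 𝓕 X ≡ true → 𝓖 X ≡ true ⊎ 𝓗 X ≡ true) → card 𝓕 ≤ card 𝓖 + card 𝓗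
card-≤-+ {zero} 𝓕 𝓖 𝓗 cover with 𝓕 [] in []∈𝓕
... | false = z≤n
... | true with 𝓖 [] | 𝓗 [] | cover [] []∈𝓕
...   | true  | _     | _       = s≤s z≤n
...   | false | true  | _       = s≤s z≤n
...   | false | false | inj₁ ()
...   | false | false | inj₂ ()
card-≤-+ {suc n} 𝓕 𝓖 𝓗 cover = begin
  card 𝓕                              ≡⟨ card-∷ 𝓕 ⟩
  lo 𝓕 + hi 𝓕                         ≤⟨ +-mono-≤ (half false) (half true) ⟩
  (lo 𝓖 + lo 𝓗) + (hi 𝓖 + hi 𝓗)       ≡⟨ interchange (lo 𝓖) (lo 𝓗) (hi 𝓖) (hi 𝓗) ⟩
  (lo 𝓖 + hi 𝓖) + (lo 𝓗 + hi 𝓗)       ≡⟨ sym (cong₂ _+_ (card-∷ 𝓖) (card-∷ 𝓗)) ⟩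
  card 𝓖 + card 𝓗                     ∎
  where
  open ≤-Reasoning
  lo hi : Fam (suc n) → ℕ
  lo 𝓘 = card (𝓘 ∘ (false ∷_))
  hi 𝓘 = card (𝓘 ∘ (true ∷_))
  half : ∀ b → card (𝓕 ∘ (b ∷_)) ≤ card (𝓖 ∘ (b ∷_)) + card (𝓗 ∘ (b ∷_))
  half b = card-≤-+ _ _ _ (λ X → cover (b ∷ X))

card-full : card {n} (λ _ → true) ≡ 2 ^ n
card-full {zero}  = refl
card-full {suc n} = trans (card-∷ {n} (λ _ → true))
                          (cong₂ _+_ (card-full {n}) (trans (card-full {n}) (sym (+-identityʳ _))))

card-cover : (𝓖 𝓗 : Fam n) → (∀ X → 𝓖 X ≡ true ⊎ 𝓗 X ≡ true) → 2 ^ n ≤ card 𝓖 + card 𝓗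
card-cover {n} 𝓖 𝓗 cover =
  subst (_≤ card 𝓖 + card 𝓗) (card-full {n}) (card-≤-+ (λ _ → true) 𝓖 𝓗 (λ X _ → cover X))

slice : Fin (suc n) → Bool → Fam (suc n) → Fam n
slice k b 𝓖 X = 𝓖 (insertAt X k b)

card-slice : (k : Fin (suc n)) (𝓖 : Fam (suc n)) → card 𝓖 ≡ card (slice k false 𝓖) + card (slice k true 𝓖)
card-slice zero          𝓖 = card-∷ 𝓖
card-slice {suc n} (suc k) 𝓖 = begin
  card 𝓖                                                  ≡⟨ card-∷ 𝓖 ⟩
  card (𝓖 ∘ (false ∷_)) + card (𝓖 ∘ (true ∷_))            ≡⟨ cong₂ _+_ (card-slice k _) (card-slice k _) ⟩
  (lo₀ + lo₁) + (hi₀ + hi₁)                               ≡⟨ interchange lo₀ lo₁ hi₀ hi₁ ⟩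
  (lo₀ + hi₀) + (lo₁ + hi₁)                               ≡⟨ sym (cong₂ _+_ (card-∷ (slice (suc k) false 𝓖))
                                                                              (card-∷ (slice (suc k) true 𝓖))) ⟩
  card (slice (suc k) false 𝓖) + card (slice (suc k) true 𝓖) ∎
  where
  open ≡-Reasoning
  lo₀ lo₁ hi₀ hi₁ : ℕ
  lo₀ = card (slice k false (𝓖 ∘ (false ∷_)))
  lo₁ = card (slice k true  (𝓖 ∘ (false ∷_)))
  hi₀ = card (slice k false (𝓖 ∘ (true ∷_)))
  hi₁ = card (slice k true  (𝓖 ∘ (true ∷_)))

#[_] : Bool → Subset n → ℕ
#[ b ] = count (_≟ᵇ b)

#-insertAt : ∀ a (X : Subset n) k → #[ a ] (insertAt X k a) ≡ suc (#[ a ] X)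
#-insertAt false X       zero    = refl
#-insertAt true  X       zero    = refl
#-insertAt a     (x ∷ X) (suc k) rewrite #-insertAt a X k with does (x ≟ᵇ a)
... | true  = refl
... | false = refl

#-complement : ∀ b (X : Subset n) → #[ b ] X + #[ not b ] X ≡ n
#-complement b     []          = refl
#-complement false (false ∷ X) = cong suc (#-complement false X)
#-complement true  (true  ∷ X) = cong suc (#-complement true X)
#-complement false (true  ∷ X) = trans (+-suc _ _) (cong suc (#-complement false X))
#-complement true  (false ∷ X) = trans (+-suc _ _) (cong suc (#-complement true X))

2^-suc : ∀ k → 2 ^ suc k ≡ 2 ^ k + 2 ^ k
2^-suc k = cong (2 ^ k +_) (+-identityʳ (2 ^ k))

card-up-cone : (X : Subset n) (𝓖 : Fam n) → (∀ {Y} → X ⊆ Y → 𝓖 Y ≡ true) → 2 ^ #[ false ] X ≤ card 𝓖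
card-up-cone []          𝓖 up rewrite up {[]} ⊆-refl = s≤s z≤n
card-up-cone (false ∷ X) 𝓖 up = begin
  2 ^ suc (#[ false ] X)                          ≡⟨ 2^-suc (#[ false ] X) ⟩
  2 ^ #[ false ] X + 2 ^ #[ false ] X             ≤⟨ +-mono-≤ (card-up-cone X _ (up ∘ out⊆))
                                                               (card-up-cone X _ (up ∘ out⊆)) ⟩
  card (𝓖 ∘ (false ∷_)) + card (𝓖 ∘ (true ∷_))   ≡⟨ sym (card-∷ 𝓖) ⟩
  card 𝓖                                          ∎
  where open ≤-Reasoning
card-up-cone (true ∷ X)  𝓖 up = begin
  2 ^ #[ false ] X                                ≤⟨ card-up-cone X _ (up ∘ s⊆s) ⟩
  card (𝓖 ∘ (true ∷_))                           ≤⟨ m≤n+m _ _ ⟩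
  card (𝓖 ∘ (false ∷_)) + card (𝓖 ∘ (true ∷_))   ≡⟨ sym (card-∷ 𝓖) ⟩
  card 𝓖                                          ∎
  where open ≤-Reasoning

card-down-cone : (X : Subset n) (𝓖 : Fam n) → (∀ {Y} → Y ⊆ X → 𝓖 Y ≡ true) → 2 ^ #[ true ] X ≤ card 𝓖
card-down-cone []          𝓖 down rewrite down {[]} ⊆-refl = s≤s z≤n
card-down-cone (true ∷ X)  𝓖 down = begin
  2 ^ suc (#[ true ] X)                           ≡⟨ 2^-suc (#[ true ] X) ⟩
  2 ^ #[ true ] X + 2 ^ #[ true ] X               ≤⟨ +-mono-≤ (card-down-cone X _ (down ∘ out⊆))
                                                               (card-down-cone X _ (down ∘ s⊆s)) ⟩
  card (𝓖 ∘ (false ∷_)) + card (𝓖 ∘ (true ∷_))   ≡⟨ sym (card-∷ 𝓖) ⟩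
  card 𝓖                                          ∎
  where open ≤-Reasoning
card-down-cone (false ∷ X) 𝓖 down = begin
  2 ^ #[ true ] X                                 ≤⟨ card-down-cone X _ (down ∘ s⊆s) ⟩
  card (𝓖 ∘ (false ∷_))                          ≤⟨ m≤m+n _ _ ⟩
  card (𝓖 ∘ (false ∷_)) + card (𝓖 ∘ (true ∷_))   ≡⟨ sym (card-∷ 𝓖) ⟩
  card 𝓖                                          ∎
  where open ≤-Reasoning

-- Comparability across a coordinate

∷-mono-⊆ : ∀ {a b} {X Y : Subset n} → a ≤ᵇ b → X ⊆ Y → a ∷ X ⊆ b ∷ Y
∷-mono-⊆ f≤t = out⊆
∷-mono-⊆ b≤b = s⊆s

⊆-head : ∀ {a b} {X Y : Subset n} → a ∷ X ⊆ b ∷ Y → a ≤ᵇ b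
⊆-head {a = false} {false} _ = b≤b
⊆-head {a = false} {true}  _ = f≤t
⊆-head {a = true}  {true}  _ = b≤b
⊆-head {a = true}  {false} aX⊆bY with () ← aX⊆bY here

insertAt-mono-⊆ : ∀ {a b} {X Y : Subset n} (k : Fin (suc n)) → a ≤ᵇ b → X ⊆ Y → insertAt X k a ⊆ insertAt Y k b
insertAt-mono-⊆ zero                    a≤b X⊆Y = ∷-mono-⊆ a≤b X⊆Y
insertAt-mono-⊆ {X = _ ∷ _} {_ ∷ _} (suc k) a≤b X⊆Y =
  ∷-mono-⊆ (⊆-head X⊆Y) (insertAt-mono-⊆ k a≤b (drop-∷-⊆ X⊆Y))

Comparable : Subset n → Subset n → Set
Comparable X Y = X ⊆ Y ⊎ Y ⊆ X

-- The Y whose copy on the far side of a split is comparable with X placed on side a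
-- (see cone-comparable): the sets above X if a is the lower side, below X otherwise.
Cone : Bool → Subset n → Subset n → Set
Cone false X Y = X ⊆ Y
Cone true  X Y = Y ⊆ X

cone-refl : ∀ a {X : Subset n} → Cone a X X
cone-refl false = ⊆-refl
cone-refl true  = ⊆-refl

card-cone : ∀ a (X : Subset n) (𝓖 : Fam n) → (∀ {Y} → Cone a X Y → 𝓖 Y ≡ true) → 2 ^ #[ a ] X ≤ card 𝓖
card-cone false = card-up-cone
card-cone true  = card-down-cone

cone-comparable : ∀ {a c} {X Y : Subset n} (k : Fin (suc n)) → a ≢ c → Cone a X Y →
                  Comparable (insertAt X k a) (insertAt Y k c)
cone-comparable {a = false} {true}  k _   X⊆Y = inj₁ (insertAt-mono-⊆ k f≤t X⊆Y)
cone-comparable {a = true}  {false} k _   Y⊆X = inj₂ (insertAt-mono-⊆ k f≤t Y⊆X)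
cone-comparable {a = false} {false} k a≢c _   = contradiction refl a≢c
cone-comparable {a = true}  {true}  k a≢c _   = contradiction refl a≢c

Coordinate : Bool → Bool → Subset n → Subset n → Set
Coordinate a b X Y = ∃ λ k → lookup X k ≡ a × lookup Y k ≡ b

coordinate-∷ : ∀ {a b x y : Bool} {X Y : Subset n} → Coordinate a b X Y → Coordinate a b (x ∷ X) (y ∷ Y)
coordinate-∷ (k , Xₖ , Yₖ) = suc k , Xₖ , Yₖ

⊈⇒coordinate : (X Y : Subset n) → ¬ X ⊆ Y → Coordinate true false X Y
⊈⇒coordinate []          []          X⊈Y = contradiction (λ ()) X⊈Y
⊈⇒coordinate (true ∷ X)  (false ∷ Y) _   = zero , refl , refl
⊈⇒coordinate (true ∷ X)  (true ∷ Y)  X⊈Y = coordinate-∷ (⊈⇒coordinate X Y (X⊈Y ∘ s⊆s))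
⊈⇒coordinate (false ∷ X) (y ∷ Y)     X⊈Y = coordinate-∷ (⊈⇒coordinate X Y (X⊈Y ∘ out⊆))

incomparable⇒coordinate : ∀ {a c} {X Y : Subset n} → ¬ Comparable X Y → a ≢ c → Coordinate a c X Y
incomparable⇒coordinate {a = true}  {false} X≁Y _   = ⊈⇒coordinate _ _ (X≁Y ∘ inj₁)
incomparable⇒coordinate {a = false} {true}  X≁Y _   with k , Yₖ , Xₖ ← ⊈⇒coordinate _ _ (X≁Y ∘ inj₂) = k , Xₖ , Yₖ
incomparable⇒coordinate {a = true}  {true}  _   a≢c = contradiction refl a≢c
incomparable⇒coordinate {a = false} {false} _   a≢c = contradiction refl a≢c

incomparable⇒nonZero : ∀ {X Y : Subset n} → ¬ Comparable X Y → NonZero n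
incomparable⇒nonZero {X = []}    {[]} X≁Y = contradiction (inj₁ λ ()) X≁Y
incomparable⇒nonZero {X = _ ∷ _}      _   = _

pigeonhole : ∀ a b (X Y : Subset n) → n < #[ a ] X + #[ b ] Y → Coordinate a b X Y
pigeonhole a b []      []      ()
pigeonhole {suc n} a b (x ∷ X) (y ∷ Y) n<#+# with x ≟ᵇ a | y ≟ᵇ b
... | yes refl | yes refl = zero , refl , refl
... | yes _    | no _     = coordinate-∷ (pigeonhole a b X Y (≤-pred n<#+#))
... | no _     | yes _    = coordinate-∷ (pigeonhole a b X Y
                              (≤-pred (subst (suc n <_) (+-suc (#[ a ] X) (#[ b ] Y)) n<#+#)))
... | no _     | no _     = coordinate-∷ (pigeonhole a b X Y (<-trans (n<1+n _) n<#+#))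

insertAt-removeAt-lookup : ∀ {a} (X : Subset (suc n)) k → lookup X k ≡ a → insertAt (removeAt X k) k a ≡ X
insertAt-removeAt-lookup X k refl = insertAt-removeAt X k

γ : ℕ → ℕ
γ zero    = 0
γ (suc m) = γ m + 2 ^ ⌊ m /2⌋

2^⌊n/2⌋≤γ : ∀ n .{{_ : NonZero n}} → 2 ^ ⌊ n /2⌋ ≤ γ n
2^⌊n/2⌋≤γ 1             = ≤-refl
2^⌊n/2⌋≤γ (suc (suc m)) = begin
  2 ^ suc ⌊ m /2⌋                    ≡⟨ 2^-suc ⌊ m /2⌋ ⟩
  2 ^ ⌊ m /2⌋ + 2 ^ ⌊ m /2⌋          ≤⟨ +-mono-≤ (≤-trans 2^⌊m/2⌋≤2^⌊1+m/2⌋ (2^⌊n/2⌋≤γ (suc m))) 2^⌊m/2⌋≤2^⌊1+m/2⌋ ⟩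
  γ (suc m) + 2 ^ ⌊ suc m /2⌋        ∎
  where
  open ≤-Reasoning
  2^⌊m/2⌋≤2^⌊1+m/2⌋ : 2 ^ ⌊ m /2⌋ ≤ 2 ^ ⌊ suc m /2⌋
  2^⌊m/2⌋≤2^⌊1+m/2⌋ = ^-monoʳ-≤ 2 (⌊n/2⌋-mono (n≤1+n m))

γ≤2^ : ∀ m → γ (suc m) ≤ 2 ^ m
γ≤2^ zero    = ≤-refl
γ≤2^ (suc m) = begin
  γ (suc m) + 2 ^ ⌊ suc m /2⌋        ≤⟨ +-mono-≤ (γ≤2^ m) (^-monoʳ-≤ 2 (≤-pred (⌊n/2⌋<n m))) ⟩
  2 ^ m + 2 ^ m                      ≡⟨ sym (2^-suc m) ⟩
  2 ^ suc m                          ∎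
  where open ≤-Reasoning

⌊t*2/2⌋≡t : ∀ t → ⌊ t * 2 /2⌋ ≡ t
⌊t*2/2⌋≡t zero    = refl
⌊t*2/2⌋≡t (suc t) = cong suc (⌊t*2/2⌋≡t t)

⌊1+t*2/2⌋≡t : ∀ t → ⌊ suc (t * 2) /2⌋ ≡ t
⌊1+t*2/2⌋≡t zero    = refl
⌊1+t*2/2⌋≡t (suc t) = cong suc (⌊1+t*2/2⌋≡t t)

γ-even : ∀ t → γ (t * 2) + 2 ≡ 2 ^ suc t
γ-odd  : ∀ t → γ (suc (t * 2)) + 2 ≡ 3 * 2 ^ t
γ-even zero    = refl
γ-even (suc t) = begin
  γ (suc (t * 2)) + 2 ^ ⌊ suc (t * 2) /2⌋ + 2   ≡⟨ cong (λ e → γ (suc (t * 2)) + 2 ^ e + 2) (⌊1+t*2/2⌋≡t t) ⟩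
  γ (suc (t * 2)) + 2 ^ t + 2                   ≡⟨ xy∙z≈xz∙y (γ (suc (t * 2))) (2 ^ t) 2 ⟩
  γ (suc (t * 2)) + 2 + 2 ^ t                   ≡⟨ cong (_+ 2 ^ t) (γ-odd t) ⟩
  3 * 2 ^ t + 2 ^ t                             ≡⟨ 3x+x≡2[2x] (2 ^ t) ⟩
  2 ^ suc (suc t)                               ∎
  where
  open ≡-Reasoning
  3x+x≡2[2x] : ∀ x → 3 * x + x ≡ 2 * (2 * x)
  3x+x≡2[2x] = solve-∀
γ-odd t = begin
  γ (t * 2) + 2 ^ ⌊ t * 2 /2⌋ + 2               ≡⟨ cong (λ e → γ (t * 2) + 2 ^ e + 2) (⌊t*2/2⌋≡t t) ⟩
  γ (t * 2) + 2 ^ t + 2                         ≡⟨ xy∙z≈xz∙y (γ (t * 2)) (2 ^ t) 2 ⟩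
  γ (t * 2) + 2 + 2 ^ t                         ≡⟨ cong (_+ 2 ^ t) (γ-even t) ⟩
  2 * 2 ^ t + 2 ^ t                             ≡⟨ 2x+x≡3x (2 ^ t) ⟩
  3 * 2 ^ t                                     ∎
  where
  open ≡-Reasoning
  2x+x≡3x : ∀ x → 2 * x + x ≡ 3 * x
  2x+x≡3x = solve-∀

bound≡γ : ∀ n → bound n ≡ γ n
bound≡γ n with n % 2 | m≡m%n+[m/n]*n n 2 | m%n<n n 2
... | zero        | n≡t*2   | _ = begin
  2 ^ (n / 2 + 1) ∸ 2            ≡⟨ cong (λ e → 2 ^ e ∸ 2) (+-comm (n / 2) 1) ⟩
  2 ^ suc (n / 2) ∸ 2            ≡⟨ cong (_∸ 2) (sym (γ-even (n / 2))) ⟩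
  γ (n / 2 * 2) + 2 ∸ 2          ≡⟨ m+n∸n≡m _ 2 ⟩
  γ (n / 2 * 2)                  ≡⟨ cong γ (sym n≡t*2) ⟩
  γ n                            ∎
  where open ≡-Reasoning
... | suc zero    | n≡1+t*2 | _ = begin
  3 * 2 ^ (n / 2) ∸ 2            ≡⟨ cong (_∸ 2) (sym (γ-odd (n / 2))) ⟩
  γ (suc (n / 2 * 2)) + 2 ∸ 2    ≡⟨ m+n∸n≡m _ 2 ⟩
  γ (suc (n / 2 * 2))            ≡⟨ cong γ (sym n≡1+t*2) ⟩
  γ n                            ∎
  where open ≡-Reasoning
... | suc (suc _) | _       | s≤s (s≤s ())

⌊n/2⌋+⌊n/2⌋≤n : ∀ m → ⌊ m /2⌋ + ⌊ m /2⌋ ≤ m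
⌊n/2⌋+⌊n/2⌋≤n m = begin
  ⌊ m /2⌋ + ⌊ m /2⌋    ≤⟨ +-monoʳ-≤ ⌊ m /2⌋ (⌊n/2⌋≤⌈n/2⌉ m) ⟩
  ⌊ m /2⌋ + ⌈ m /2⌉    ≡⟨ ⌊n/2⌋+⌈n/2⌉≡n m ⟩
  m                    ∎
  where open ≤-Reasoning

module _ {m : ℕ} (b : Bool) where

  private
    h : ℕ
    h = ⌊ m /2⌋

  #-other-side : (X : Subset (suc m)) → #[ not b ] X ≤ h → h < #[ b ] X
  #-other-side X #¬b≤h = +-cancelʳ-< h h (#[ b ] X) (begin-strict
    h + h                        ≤⟨ ⌊n/2⌋+⌊n/2⌋≤n m ⟩
    m                            <⟨ n<1+n m ⟩
    suc m                        ≡⟨ sym (#-complement b X) ⟩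
    #[ b ] X + #[ not b ] X      ≤⟨ +-monoʳ-≤ (#[ b ] X) #¬b≤h ⟩
    #[ b ] X + h                 ∎)
    where open ≤-Reasoning

  #-same-side : (X Y : Subset (suc m)) → #[ not b ] X ≤ h → #[ not b ] Y ≤ h → suc m < #[ b ] X + #[ b ] Y
  #-same-side X Y #¬bX≤h #¬bY≤h = +-cancelʳ-≤ m _ _ (begin
    suc (suc m) + m                                          ≡⟨ sym (+-suc (suc m) m) ⟩
    suc m + suc m                                            ≡⟨ sym (cong₂ _+_ (#-complement b X) (#-complement b Y)) ⟩
    (#[ b ] X + #[ not b ] X) + (#[ b ] Y + #[ not b ] Y)    ≡⟨ interchange (#[ b ] X) _ _ _ ⟩
    (#[ b ] X + #[ b ] Y) + (#[ not b ] X + #[ not b ] Y)    ≤⟨ +-monoʳ-≤ (#[ b ] X + #[ b ] Y) (+-mono-≤ #¬bX≤h #¬bY≤h) ⟩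
    (#[ b ] X + #[ b ] Y) + (h + h)                          ≤⟨ +-monoʳ-≤ (#[ b ] X + #[ b ] Y) (⌊n/2⌋+⌊n/2⌋≤n m) ⟩
    (#[ b ] X + #[ b ] Y) + m                                ∎)
    where open ≤-Reasoning

-- An up-set and a down-set

UpClosed DownClosed : Fam n → Set
UpClosed   𝓤 = ∀ {X Y} → X ⊆ Y → 𝓤 X ≡ true → 𝓤 Y ≡ true
DownClosed 𝓓 = ∀ {X Y} → X ⊆ Y → 𝓓 Y ≡ true → 𝓓 X ≡ true

InBoth InNeither : Fam n → Fam n → Subset n → Set
InBoth    𝓤 𝓓 X = 𝓤 X ≡ true  × 𝓓 X ≡ true
InNeither 𝓤 𝓓 X = 𝓤 X ≡ false × 𝓓 X ≡ false

_⊕_ : Fam n → Fam n → Fam n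
(𝓤 ⊕ 𝓓) X = 𝓤 X xor 𝓓 X

module _ {𝓤 𝓓 : Fam n} where

  ⊕-trichotomy : ∀ X → (𝓤 ⊕ 𝓓) X ≡ true ⊎ InBoth 𝓤 𝓓 X ⊎ InNeither 𝓤 𝓓 X
  ⊕-trichotomy X with 𝓤 X | 𝓓 X
  ... | true  | true  = inj₂ (inj₁ (refl , refl))
  ... | true  | false = inj₁ refl
  ... | false | true  = inj₁ refl
  ... | false | false = inj₂ (inj₂ (refl , refl))

  ⊕-intro-true : ∀ {X} → 𝓤 X ≡ true ⊎ 𝓓 X ≡ true → ¬ InBoth 𝓤 𝓓 X → (𝓤 ⊕ 𝓓) X ≡ true
  ⊕-intro-true {X} X∈∪ X∉∩ with 𝓤 X | 𝓓 X | X∈∪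
  ... | true  | true  | _       = contradiction (refl , refl) X∉∩
  ... | true  | false | _       = refl
  ... | false | true  | _       = refl
  ... | false | false | inj₁ ()
  ... | false | false | inj₂ ()

  ⊕-intro-false : ∀ {X} → 𝓤 X ≡ false ⊎ 𝓓 X ≡ false → ¬ InNeither 𝓤 𝓓 X → (𝓤 ⊕ 𝓓) X ≡ true
  ⊕-intro-false {X} X∉∩ X∈∪ with 𝓤 X | 𝓓 X | X∉∩
  ... | false | false | _       = contradiction (refl , refl) X∈∪
  ... | true  | false | _       = refl
  ... | false | true  | _       = refl
  ... | true  | true  | inj₁ ()
  ... | true  | true  | inj₂ ()

  module _ (𝓤-up : UpClosed 𝓤) (𝓓-down : DownClosed 𝓓) where

    comparable-to-both : ∀ {X Y} → InBoth 𝓤 𝓓 X → Comparable X Y → ¬ InBoth 𝓤 𝓓 Y → (𝓤 ⊕ 𝓓) Y ≡ true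
    comparable-to-both (X∈𝓤 , _) (inj₁ X⊆Y) = ⊕-intro-true (inj₁ (𝓤-up X⊆Y X∈𝓤))
    comparable-to-both (_ , X∈𝓓) (inj₂ Y⊆X) = ⊕-intro-true (inj₂ (𝓓-down Y⊆X X∈𝓓))

    comparable-to-neither : ∀ {X Y} → InNeither 𝓤 𝓓 X → Comparable X Y → ¬ InNeither 𝓤 𝓓 Y → (𝓤 ⊕ 𝓓) Y ≡ true
    comparable-to-neither (_ , X∉𝓓) (inj₁ X⊆Y) = ⊕-intro-false (inj₂ (¬-not λ Y∈𝓓 → clash (𝓓-down X⊆Y Y∈𝓓) X∉𝓓))
    comparable-to-neither (X∉𝓤 , _) (inj₂ Y⊆X) = ⊕-intro-false (inj₁ (¬-not λ Y∈𝓤 → clash (𝓤-up Y⊆X Y∈𝓤) X∉𝓤))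

    both-neither-incomparable : ∀ {X Y} → InBoth 𝓤 𝓓 X → InNeither 𝓤 𝓓 Y → ¬ Comparable X Y
    both-neither-incomparable (X∈𝓤 , _) (Y∉𝓤 , _) (inj₁ X⊆Y) = clash (𝓤-up X⊆Y X∈𝓤) Y∉𝓤
    both-neither-incomparable (_ , X∈𝓓) (_ , Y∉𝓓) (inj₂ Y⊆X) = clash (𝓓-down Y⊆X X∈𝓓) Y∉𝓓

SymDiffBound : ℕ → Set
SymDiffBound n = ∀ {𝓤 𝓓 : Fam n} → UpClosed 𝓤 → DownClosed 𝓓 →
                 ∃ (InBoth 𝓤 𝓓) → ∃ (InNeither 𝓤 𝓓) → γ n ≤ card (𝓤 ⊕ 𝓓)

module Split {m : ℕ} (IH : SymDiffBound m) {𝓤 𝓓 : Fam (suc m)} (𝓤-up : UpClosed 𝓤) (𝓓-down : DownClosed 𝓓)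
             (k : Fin (suc m)) where

  private
    h : ℕ
    h = ⌊ m /2⌋

  𝓤[_] 𝓓[_] : Bool → Fam m
  𝓤[ b ] = slice k b 𝓤
  𝓓[ b ] = slice k b 𝓓

  𝓤[]-up : ∀ b → UpClosed 𝓤[ b ]
  𝓤[]-up b = 𝓤-up ∘ insertAt-mono-⊆ k b≤b

  𝓓[]-down : ∀ b → DownClosed 𝓓[ b ]
  𝓓[]-down b = 𝓓-down ∘ insertAt-mono-⊆ k b≤b

  Δ : Bool → ℕ
  Δ b = card (slice k b (𝓤 ⊕ 𝓓))

  Meets Misses : Bool → Set
  Meets  b = ∃ (InBoth 𝓤[ b ] 𝓓[ b ])
  Misses b = ∃ (InNeither 𝓤[ b ] 𝓓[ b ])

  meets? : ∀ b → Dec (Meets b)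
  meets? b = anySubset? λ X → (𝓤[ b ] X ≟ᵇ true) ×-dec (𝓓[ b ] X ≟ᵇ true)

  misses? : ∀ b → Dec (Misses b)
  misses? b = anySubset? λ X → (𝓤[ b ] X ≟ᵇ false) ×-dec (𝓓[ b ] X ≟ᵇ false)

  card-⊕ : ∀ {a c} → a ≢ c → card (𝓤 ⊕ 𝓓) ≡ Δ a + Δ c
  card-⊕ {false} {true}  _   = card-slice k (𝓤 ⊕ 𝓓)
  card-⊕ {true}  {false} _   = trans (card-slice k (𝓤 ⊕ 𝓓)) (+-comm (Δ false) (Δ true))
  card-⊕ {false} {false} a≢c = contradiction refl a≢c
  card-⊕ {true}  {true}  a≢c = contradiction refl a≢c

  mixed-half-bound : ∀ b → Meets b → Misses b → γ m ≤ Δ b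
  mixed-half-bound b = IH (𝓤[]-up b) (𝓓[]-down b)

  mixed-halves-bound : ∀ {a c} → Meets a → Misses a → Meets c → Misses c → γ (suc m) ≤ Δ a + Δ c
  mixed-halves-bound {a} {c} meetsₐ@(_ , X∈∩) missesₐ@(_ , Y∉∪) meets꜀ misses꜀ =
    +-mono-≤ (mixed-half-bound a meetsₐ missesₐ) (≤-trans 2^h≤γ (mixed-half-bound c meets꜀ misses꜀))
    where
    2^h≤γ : 2 ^ h ≤ γ m
    2^h≤γ = 2^⌊n/2⌋≤γ m {{incomparable⇒nonZero
              (both-neither-incomparable {𝓤 = 𝓤[ a ]} {𝓓[ a ]} (𝓤[]-up a) (𝓓[]-down a) X∈∩ Y∉∪)}}

  meet-gain : ∀ {a c X} → a ≢ c → InBoth 𝓤[ a ] 𝓓[ a ] X → ¬ Meets c → 2 ^ #[ a ] X ≤ Δ c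
  meet-gain {a} {X = X} a≢c X∈∩ ∄meet = card-cone a X _ λ Y∈cone →
    comparable-to-both {𝓤 = 𝓤} {𝓓} 𝓤-up 𝓓-down X∈∩ (cone-comparable k a≢c Y∈cone) (λ Y∈∩ → ∄meet (_ , Y∈∩))

  miss-gain : ∀ {a c X} → a ≢ c → InNeither 𝓤[ a ] 𝓓[ a ] X → ¬ Misses c → 2 ^ #[ a ] X ≤ Δ c
  miss-gain {a} {X = X} a≢c X∉∪ ∄miss = card-cone a X _ λ Y∈cone →
    comparable-to-neither {𝓤 = 𝓤} {𝓓} 𝓤-up 𝓓-down X∉∪ (cone-comparable k a≢c Y∈cone) (λ Y∉∪ → ∄miss (_ , Y∉∪))

  no-miss-no-meet : ∀ {a c} → a ≢ c → ¬ Misses a → ¬ Meets c → 2 ^ m ≤ Δ a + Δ c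
  no-miss-no-meet {a} {c} a≢c ∄miss ∄meet = card-cover _ _ one-side
    where
    one-side : ∀ Y → slice k a (𝓤 ⊕ 𝓓) Y ≡ true ⊎ slice k c (𝓤 ⊕ 𝓓) Y ≡ true
    one-side Y with ⊕-trichotomy {𝓤 = 𝓤} {𝓓} (insertAt Y k a)
    ... | inj₁ Yₐ∈⊕        = inj₁ Yₐ∈⊕
    ... | inj₂ (inj₁ Yₐ∈∩) = inj₂ (comparable-to-both {𝓤 = 𝓤} {𝓓} 𝓤-up 𝓓-down Yₐ∈∩
                                     (cone-comparable k a≢c (cone-refl a)) (λ Y꜀∈∩ → ∄meet (Y , Y꜀∈∩)))
    ... | inj₂ (inj₂ Yₐ∉∪) = contradiction (Y , Yₐ∉∪) ∄miss

  same-side : ∀ {a c X Y} → a ≢ c → InBoth 𝓤[ a ] 𝓓[ a ] X → InNeither 𝓤[ a ] 𝓓[ a ] Y →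
              h ≤ #[ a ] X → h ≤ #[ a ] Y → γ (suc m) ≤ Δ a + Δ c
  same-side {a} {c} a≢c X∈∩ Y∉∪ h≤#X h≤#Y = by-other-half (meets? c) (misses? c)
    where
    mixed : γ m ≤ Δ a
    mixed = mixed-half-bound a (_ , X∈∩) (_ , Y∉∪)
    by-other-half : Dec (Meets c) → Dec (Misses c) → γ (suc m) ≤ Δ a + Δ c
    by-other-half (no ∄meet) _          = +-mono-≤ mixed (≤-trans (^-monoʳ-≤ 2 h≤#X) (meet-gain a≢c X∈∩ ∄meet))
    by-other-half (yes _)    (no ∄miss) = +-mono-≤ mixed (≤-trans (^-monoʳ-≤ 2 h≤#Y) (miss-gain a≢c Y∉∪ ∄miss))
    by-other-half (yes meet) (yes miss) = mixed-halves-bound (_ , X∈∩) (_ , Y∉∪) meet miss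

  opposite-sides : ∀ {a c X Y} → a ≢ c → InBoth 𝓤[ a ] 𝓓[ a ] X → InNeither 𝓤[ c ] 𝓓[ c ] Y →
                   h ≤ #[ a ] X → h ≤ #[ c ] Y → γ (suc m) ≤ Δ a + Δ c
  opposite-sides {a} {c} a≢c X∈∩ Y∉∪ h≤#X h≤#Y with meets? c | misses? a
  ... | yes meet | yes miss = mixed-halves-bound (_ , X∈∩) miss meet (_ , Y∉∪)
  ... | no ∄meet | yes miss = +-mono-≤ (mixed-half-bound a (_ , X∈∩) miss)
                                       (≤-trans (^-monoʳ-≤ 2 h≤#X) (meet-gain a≢c X∈∩ ∄meet))
  ... | yes meet | no ∄miss = subst (γ (suc m) ≤_) (+-comm (Δ c) (Δ a))
                                (+-mono-≤ (mixed-half-bound c meet (_ , Y∉∪))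
                                          (≤-trans (^-monoʳ-≤ 2 h≤#Y) (miss-gain (≢-sym a≢c) Y∉∪ ∄miss)))
  ... | no ∄meet | no ∄miss = ≤-trans (γ≤2^ m) (no-miss-no-meet a≢c ∄miss ∄meet)

  split-bound : ∀ {a c X Y} → InBoth 𝓤[ a ] 𝓓[ a ] X → InNeither 𝓤[ c ] 𝓓[ c ] Y →
                h ≤ #[ a ] X → h ≤ #[ c ] Y → γ (suc m) ≤ card (𝓤 ⊕ 𝓓)
  split-bound {a} {c} X∈∩ Y∉∪ h≤#X h≤#Y with a ≟ᵇ c
  ... | yes refl = subst (γ (suc m) ≤_) (sym (card-⊕ a≢¬a)) (same-side a≢¬a X∈∩ Y∉∪ h≤#X h≤#Y)
    where
    a≢¬a : a ≢ not a
    a≢¬a = not-¬ refl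
  ... | no a≢c   = subst (γ (suc m) ≤_) (sym (card-⊕ a≢c)) (opposite-sides a≢c X∈∩ Y∉∪ h≤#X h≤#Y)

module Step {m : ℕ} (IH : SymDiffBound m) {𝓤 𝓓 : Fam (suc m)} (𝓤-up : UpClosed 𝓤) (𝓓-down : DownClosed 𝓓)
            {X Y} (X∈∩ : InBoth 𝓤 𝓓 X) (Y∉∪ : InNeither 𝓤 𝓓 Y) where

  private
    h : ℕ
    h = ⌊ m /2⌋

  split-at : ∀ {a c} → Coordinate a c X Y → h < #[ a ] X → h < #[ c ] Y → γ (suc m) ≤ card (𝓤 ⊕ 𝓓)
  split-at {a} {c} (k , Xₖ , Yₖ) h<#X h<#Y = split-bound X′∈∩ Y′∉∪ (≤-pred h<#X′) (≤-pred h<#Y′)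
    where
    open Split IH 𝓤-up 𝓓-down k
    X≡ : insertAt (removeAt X k) k a ≡ X
    X≡ = insertAt-removeAt-lookup X k Xₖ
    Y≡ : insertAt (removeAt Y k) k c ≡ Y
    Y≡ = insertAt-removeAt-lookup Y k Yₖ
    X′∈∩ : InBoth 𝓤[ a ] 𝓓[ a ] (removeAt X k)
    X′∈∩ = subst (InBoth 𝓤 𝓓) (sym X≡) X∈∩
    Y′∉∪ : InNeither 𝓤[ c ] 𝓓[ c ] (removeAt Y k)
    Y′∉∪ = subst (InNeither 𝓤 𝓓) (sym Y≡) Y∉∪
    h<#X′ : h < suc (#[ a ] (removeAt X k))
    h<#X′ = subst (h <_) (trans (cong #[ a ] (sym X≡)) (#-insertAt a _ k)) h<#X
    h<#Y′ : h < suc (#[ c ] (removeAt Y k))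
    h<#Y′ = subst (h <_) (trans (cong #[ c ] (sym Y≡)) (#-insertAt c _ k)) h<#Y

  X≁Y : ¬ Comparable X Y
  X≁Y = both-neither-incomparable 𝓤-up 𝓓-down X∈∩ Y∉∪

  large-side : (Z : Subset (suc m)) → ∃ λ a → h < #[ a ] Z
  large-side Z with h <? #[ true ] Z
  ... | yes h<#Z = true , h<#Z
  ... | no  h≮#Z = false , #-other-side false Z (≮⇒≥ h≮#Z)

  -- Put X and Y on opposite sides if each has a large side different from the other's;
  -- otherwise both have just one large side, the same one, and pigeonhole finds a coordinate.
  γ≤card-⊕ : γ (suc m) ≤ card (𝓤 ⊕ 𝓓)
  γ≤card-⊕ with a , h<#ₐX ← large-side X | h <? #[ not a ] Y
  ... | yes h<#¬ₐY = split-at (incomparable⇒coordinate X≁Y (not-¬ refl)) h<#ₐX h<#¬ₐY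
  ... | no  h≮#¬ₐY with h <? #[ not a ] X | #-other-side a Y (≮⇒≥ h≮#¬ₐY)
  ...   | yes h<#¬ₐX | h<#ₐY = split-at (incomparable⇒coordinate X≁Y (≢-sym (not-¬ refl))) h<#¬ₐX h<#ₐY
  ...   | no  h≮#¬ₐX | h<#ₐY =
    split-at (pigeonhole a a X Y (#-same-side a X Y (≮⇒≥ h≮#¬ₐX) (≮⇒≥ h≮#¬ₐY))) h<#ₐX h<#ₐY

symDiffBound : ∀ n → SymDiffBound n
symDiffBound zero    _    _      _          _          = z≤n
symDiffBound (suc m) 𝓤-up 𝓓-down (_ , X∈∩) (_ , Y∉∪) = Step.γ≤card-⊕ (symDiffBound m) 𝓤-up 𝓓-down X∈∩ Y∉∪

-- Up-sets, down-sets and extremal sets of a family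

∈-allSubsets : (X : Subset n) → X ∈ allSubsets n
∈-allSubsets []                  = Any.here refl
∈-allSubsets {suc n} (false ∷ X) = ∈-++⁺ˡ (∈-map⁺ (false ∷_) (∈-allSubsets X))
∈-allSubsets {suc n} (true  ∷ X) = ∈-++⁺ʳ (map (false ∷_) (allSubsets n)) (∈-map⁺ (true ∷_) (∈-allSubsets X))

module _ (p : Fam n) where

  any-allSubsets⁺ : ∀ {X} → p X ≡ true → any p (allSubsets n) ≡ true
  any-allSubsets⁺ {X} pX = to T-≡ (any⁺ p (lose (∈-allSubsets X) (from T-≡ pX)))

  any-allSubsets⁻ : any p (allSubsets n) ≡ true → ∃ λ X → T (p X)
  any-allSubsets⁻ some = satisfied (any⁻ p (allSubsets n) (from T-≡ some))

module _ (𝓖 : Fam n) where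

  ∂⁺-intro : ∀ {G X} → 𝓖 G ≡ true → G ⊆ X → ∂⁺ 𝓖 X ≡ true
  ∂⁺-intro {G} {X} G∈𝓖 G⊆X = any-allSubsets⁺ (λ G → 𝓖 G ∧ does (G ⊆? X)) (cong₂ _∧_ G∈𝓖 (dec-true (G ⊆? X) G⊆X))

  ∂⁻-intro : ∀ {G X} → 𝓖 G ≡ true → X ⊆ G → ∂⁻ 𝓖 X ≡ true
  ∂⁻-intro {G} {X} G∈𝓖 X⊆G = any-allSubsets⁺ (λ G → 𝓖 G ∧ does (X ⊆? G)) (cong₂ _∧_ G∈𝓖 (dec-true (X ⊆? G) X⊆G))

  ∂⁺-elim : ∀ {X} → ∂⁺ 𝓖 X ≡ true → ∃ λ G → 𝓖 G ≡ true × G ⊆ X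
  ∂⁺-elim {X} X∈∂⁺ with G , G∈𝓖∧G⊆X ← any-allSubsets⁻ _ X∈∂⁺ with G∈𝓖 , G⊆X ← to T-∧ G∈𝓖∧G⊆X =
    G , to T-≡ G∈𝓖 , toWitness (subst T (sym (isYes≗does (G ⊆? X))) G⊆X)

  ∂⁻-elim : ∀ {X} → ∂⁻ 𝓖 X ≡ true → ∃ λ G → 𝓖 G ≡ true × X ⊆ G
  ∂⁻-elim {X} X∈∂⁻ with G , G∈𝓖∧X⊆G ← any-allSubsets⁻ _ X∈∂⁻ with G∈𝓖 , X⊆G ← to T-∧ G∈𝓖∧X⊆G =
    G , to T-≡ G∈𝓖 , toWitness (subst T (sym (isYes≗does (X ⊆? G))) X⊆G)

  ∂⁺-up : UpClosed (∂⁺ 𝓖)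
  ∂⁺-up X⊆Y X∈∂⁺ with G , G∈𝓖 , G⊆X ← ∂⁺-elim X∈∂⁺ = ∂⁺-intro G∈𝓖 (⊆-trans G⊆X X⊆Y)

  ∂⁻-down : DownClosed (∂⁻ 𝓖)
  ∂⁻-down X⊆Y Y∈∂⁻ with G , G∈𝓖 , Y⊆G ← ∂⁻-elim Y∈∂⁻ = ∂⁻-intro G∈𝓖 (⊆-trans X⊆Y Y⊆G)

_∪_ : Fam n → Fam n → Fam n
(𝓖 ∪ 𝓗) X = 𝓖 X ∨ 𝓗 X

-- Definitionally 𝓕⁺ 𝓐 𝓑 = ExtremalOutside _⊂?_ (∂⁻ 𝓐 ∪ ∂⁻ 𝓑)
-- and 𝓕⁻ 𝓐 𝓑 = ExtremalOutside (flip _⊂?_) (∂⁺ 𝓐 ∪ ∂⁺ 𝓑).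
ExtremalOutside : {_≺_ : Rel (Subset n) 0ℓ} → Decidable _≺_ → Fam n → Fam n
ExtremalOutside {n} _≺?_ 𝓖 F = not (𝓖 F) ∧ all (λ Y → not (does (Y ≺? F)) ∨ 𝓖 Y) (allSubsets n)

module _ {_≺_ : Rel (Subset n) 0ℓ} (_≺?_ : Decidable _≺_) (≺-wellFounded : WellFounded _≺_)
         {_≼_ : Rel (Subset n) 0ℓ} (≼-refl : Reflexive _≼_) (≼-trans : Transitive _≼_) (≺⇒≼ : _≺_ ⇒ _≼_)
         (𝓖 : Fam n) where

  extremalOutside-≼ : ∀ {Z} → 𝓖 Z ≡ false → ∃ λ F → F ≼ Z × ExtremalOutside _≺?_ 𝓖 F ≡ true
  extremalOutside-≼ {Z} = below (≺-wellFounded Z)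
    where
    below : ∀ {Z} → Acc _≺_ Z → 𝓖 Z ≡ false → ∃ λ F → F ≼ Z × ExtremalOutside _≺?_ 𝓖 F ≡ true
    below {Z} (acc rec) Z∉𝓖 with anySubset? (λ Y → (Y ≺? Z) ×-dec (𝓖 Y ≟ᵇ false))
    ... | yes (Y , Y≺Z , Y∉𝓖) with F , F≼Y , F-extremal ← below (rec Y≺Z) Y∉𝓖 =
      F , ≼-trans F≼Y (≺⇒≼ Y≺Z) , F-extremal
    ... | no ∄Y = Z , ≼-refl , cong₂ _∧_ (cong not Z∉𝓖) (to T-≡ (all⁻ _ (universal ≺Z⇒∈𝓖 (allSubsets n))))
      where
      ≺Z⇒∈𝓖 : ∀ Y → T (not (does (Y ≺? Z)) ∨ 𝓖 Y)
      ≺Z⇒∈𝓖 Y with Y ≺? Z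
      ... | no _    = _
      ... | yes Y≺Z with 𝓖 Y in Y∈𝓖
      ...   | true  = _
      ...   | false = contradiction (Y , Y≺Z , Y∈𝓖) ∄Y

minimalOutside-⊆ : (𝓖 : Fam n) → ∀ {Z} → 𝓖 Z ≡ false → ∃ λ F → F ⊆ Z × ExtremalOutside _⊂?_ 𝓖 F ≡ true
minimalOutside-⊆ = extremalOutside-≼ _⊂?_ ⊂-wellFounded {_≼_ = _⊆_} ⊆-refl ⊆-trans proj₁

maximalOutside-⊇ : (𝓖 : Fam n) → ∀ {Z} → 𝓖 Z ≡ false → ∃ λ F → Z ⊆ F × ExtremalOutside (flip _⊂?_) 𝓖 F ≡ true
maximalOutside-⊇ = extremalOutside-≼ (flip _⊂?_) ⊃-wellFounded {_≼_ = flip _⊆_} ⊆-refl (flip ⊆-trans) proj₁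

-- Two separated families

Separated : Fam n → Fam n → Set
Separated 𝓐 𝓑 = ∀ {A B} → 𝓐 A ≡ true → 𝓑 B ≡ true → ¬ Comparable A B

twoComponents⇒separated : ∀ {𝓕 𝓐 𝓑 : Fam n} → TwoComponents 𝓕 𝓐 𝓑 → Separated 𝓐 𝓑
twoComponents⇒separated (_ , disjoint , _ , _ , _ , _ , nonadjacent) {A} {B} A∈𝓐 B∈𝓑 A~B =
  nonadjacent A B A∈𝓐 B∈𝓑 (A≢B , A~B)
  where
  A≢B : A ≢ B
  A≢B refl = clash (cong₂ _∧_ A∈𝓐 B∈𝓑) (disjoint A)

module _ {𝓐 𝓑 : Fam n} (separated : Separated 𝓐 𝓑) where

  ∂⁺-∂⁻-disjoint : ∀ {Z} → ∂⁺ 𝓐 Z ≡ true → ∂⁻ 𝓑 Z ≡ false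
  ∂⁺-∂⁻-disjoint Z∈∂⁺𝓐 = ¬-not λ Z∈∂⁻𝓑 →
    let _ , A∈𝓐 , A⊆Z = ∂⁺-elim 𝓐 Z∈∂⁺𝓐
        _ , B∈𝓑 , Z⊆B = ∂⁻-elim 𝓑 Z∈∂⁻𝓑
    in separated A∈𝓐 B∈𝓑 (inj₁ (⊆-trans A⊆Z Z⊆B))

  ∂⁻-∂⁺-disjoint : ∀ {Z} → ∂⁻ 𝓐 Z ≡ true → ∂⁺ 𝓑 Z ≡ false
  ∂⁻-∂⁺-disjoint Z∈∂⁻𝓐 = ¬-not λ Z∈∂⁺𝓑 →
    let _ , A∈𝓐 , Z⊆A = ∂⁻-elim 𝓐 Z∈∂⁻𝓐
        _ , B∈𝓑 , B⊆Z = ∂⁺-elim 𝓑 Z∈∂⁺𝓑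
    in separated A∈𝓐 B∈𝓑 (inj₂ (⊆-trans B⊆Z Z⊆A))

  𝓐⊆∂⁺∩∂⁻ : ∀ {A} → 𝓐 A ≡ true → InBoth (∂⁺ 𝓐) (∂⁻ 𝓐) A
  𝓐⊆∂⁺∩∂⁻ A∈𝓐 = ∂⁺-intro 𝓐 A∈𝓐 ⊆-refl , ∂⁻-intro 𝓐 A∈𝓐 ⊆-refl

  𝓑∩[∂⁺∪∂⁻]≡∅ : ∀ {B} → 𝓑 B ≡ true → InNeither (∂⁺ 𝓐) (∂⁻ 𝓐) B
  𝓑∩[∂⁺∪∂⁻]≡∅ B∈𝓑 = ¬-not (λ B∈∂⁺𝓐 → clash (∂⁻-intro 𝓑 B∈𝓑 ⊆-refl) (∂⁺-∂⁻-disjoint B∈∂⁺𝓐))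
                   , ¬-not (λ B∈∂⁻𝓐 → clash (∂⁺-intro 𝓑 B∈𝓑 ⊆-refl) (∂⁻-∂⁺-disjoint B∈∂⁻𝓐))

  ∂⁺⊕∂⁻⊆∂⁺𝓕⁺∪∂⁻𝓕⁻ : ∀ Z → (∂⁺ 𝓐 ⊕ ∂⁻ 𝓐) Z ≡ true → ∂⁺ (𝓕⁺ 𝓐 𝓑) Z ≡ true ⊎ ∂⁻ (𝓕⁻ 𝓐 𝓑) Z ≡ true
  ∂⁺⊕∂⁻⊆∂⁺𝓕⁺∪∂⁻𝓕⁻ Z _ with ∂⁺ 𝓐 Z in Z∈∂⁺𝓐 | ∂⁻ 𝓐 Z in Z∈∂⁻𝓐
  ... | true  | false
    with F , F⊆Z , F∈𝓕⁺ ← minimalOutside-⊆ (∂⁻ 𝓐 ∪ ∂⁻ 𝓑) (cong₂ _∨_ Z∈∂⁻𝓐 (∂⁺-∂⁻-disjoint Z∈∂⁺𝓐)) =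
      inj₁ (∂⁺-intro _ F∈𝓕⁺ F⊆Z)
  ... | false | true
    with F , Z⊆F , F∈𝓕⁻ ← maximalOutside-⊇ (∂⁺ 𝓐 ∪ ∂⁺ 𝓑) (cong₂ _∨_ Z∈∂⁺𝓐 (∂⁻-∂⁺-disjoint Z∈∂⁻𝓐)) =
      inj₂ (∂⁻-intro _ F∈𝓕⁻ Z⊆F)

lemma4p8 : (n : ℕ) (𝓕 𝓐 𝓑 : Fam n)
    → ¬ Connected 𝓕
    → (∀ X → 𝓕 X ≡ false → Connected (insert X 𝓕))
    → TwoComponents 𝓕 𝓐 𝓑
    → bound n ≤ card (∂⁺ (𝓕⁺ 𝓐 𝓑)) + card (∂⁻ (𝓕⁻ 𝓐 𝓑))
lemma4p8 n 𝓕 𝓐 𝓑 _ _ components@(_ , _ , (A , A∈𝓐) , (B , B∈𝓑) , _) = begin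
  bound n                                        ≡⟨ bound≡γ n ⟩
  γ n                                            ≤⟨ symDiffBound n (∂⁺-up 𝓐) (∂⁻-down 𝓐) (A , 𝓐⊆∂⁺∩∂⁻ separated A∈𝓐)
                                                                                        (B , 𝓑∩[∂⁺∪∂⁻]≡∅ separated B∈𝓑) ⟩
  card (∂⁺ 𝓐 ⊕ ∂⁻ 𝓐)                            ≤⟨ card-≤-+ _ _ _ (∂⁺⊕∂⁻⊆∂⁺𝓕⁺∪∂⁻𝓕⁻ separated) ⟩
  card (∂⁺ (𝓕⁺ 𝓐 𝓑)) + card (∂⁻ (𝓕⁻ 𝓐 𝓑))    ∎
  where
  open ≤-Reasoning
  separated : Separated 𝓐 𝓑
  separated = twoComponents⇒separated components
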